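{- Let $r \geq 3$ and let $\mathcal{H}'$ be the $K_{r+1}^r$-decomposition of a friendship $r$-hypergraph $\mathcal{H}$. For each hyperedge $q \in E(\mathcal{H}')$ and each vertex $z \notin q$, \[ |\{q' \in E(\mathcal{H}') : z \in q' \text{ and } |q' \cap q| = r-1 \}| \leq \left\lfloor \frac{(r+1)(3r-4)}{6} \right\rfloor. \]
   Context: For an $r$-uniform hypergraph $\mathcal{H}$ and a set of vertices $A$, a vertex $u \notin A$ is a friend of $A$ in $\mathcal{H}$ if for every $B \subseteq A$ with $|B| = r-1$, the set $B \cup \{u\}$ is a hyperedge of $\mathcal{H}$. An $r$-uniform hypergraph is a friendship $r$-hypergraph if every set of $r$ vertices has exactly one friend. The $K_{r+1}^r$-decomposition of $\mathcal{H}$ is the $(r+1)$-uniform hypergraph $\mathcal{H}'$ on $V(\mathcal{H})$ whose hyperedges are all $(r+1)$-subsets of $V(\mathcal{H})$ all of whose $r$-subsets are hyperedges of $\mathcal{H}$. -}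

module Defs where

open import Data.Nat using (ℕ; suc; _∸_)
open import Data.Fin using (Fin)
open import Data.Fin.Subset using (Subset; _∈_; _∉_; _⊆_; _∩_; _∪_; ⁅_⁆; ∣_∣)
open import Data.Product using (Σ; _×_)
open import Data.List using (List; length)
open import Data.List.Relation.Unary.All using (All)
open import Data.List.Relation.Unary.Unique.Propositional using (Unique)
open import Relation.Binary.PropositionalEquality using (_≡_)

Hypergraph : ℕ → Set₁
Hypergraph n = Subset n → Set

Uniform : ∀ {n} → ℕ → Hypergraph n → Set
Uniform r H = ∀ e → H e → ∣ e ∣ ≡ r

IsFriend : ∀ {n} → ℕ → Hypergraph n → Subset n → Fin n → Set
IsFriend r H A u = u ∉ A × (∀ B → B ⊆ A → ∣ B ∣ ≡ r ∸ 1 → H (B ∪ ⁅ u ⁆))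

IsFriendshipHypergraph : ∀ {n} → ℕ → Hypergraph n → Set
IsFriendshipHypergraph r H =
  Uniform r H ×
  (∀ A → ∣ A ∣ ≡ r →
     Σ _ λ u → IsFriend r H A u × (∀ v → IsFriend r H A v → v ≡ u))

Decomposition : ∀ {n} → ℕ → Hypergraph n → Hypergraph n
Decomposition r H q = ∣ q ∣ ≡ suc r × (∀ B → B ⊆ q → ∣ B ∣ ≡ r → H B)

-- "The set {x : P x} of subsets has at most k elements": every
-- duplicate-free list of elements satisfying P has length ≤ k.
AtMost : ∀ {n} → (Subset n → Set) → ℕ → Set
AtMost {n} P k = (xs : List (Subset n)) → Unique xs → All P xs → length xs Data.Nat.≤ k

module Submission where

-- Fix q ∈ H′ and z ∉ q. A counted q′ misses exactly two vertices a, b of q and so contains the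
-- r-set Y a b = (q ∖ {a, b}) ∪ {z}. An r-set lies in at most one hyperedge of H′ (the other vertex
-- is its unique friend), so distinct q′ miss distinct pairs, and a missed pair has Y a b ∈ H.
-- Friendship rules out a vertex a of q with Y a b ∈ H for all b, and a pair a, b with
-- Y a c, Y b c ∈ H for all c. Hence the pairs of q missed by no q′ form a graph on the r + 1
-- vertices of q with no isolated vertex and no edge between two leaves, which has at least
-- 2(r + 1)/3 edges. So there are at most r(r + 1)/2 - 2(r + 1)/3 = (r + 1)(3r - 4)/6 of the q′.

open import Defs
open import Level using (Level)
import Data.Nat as ℕ
open import Data.Nat using (ℕ; zero; suc; _≤_; _<_; _+_; _*_; _∸_; z≤n; s≤s)
open import Data.Nat.Properties hiding (_≟_)
open import Data.Nat.DivMod using (_/_; m*n/n≡m; /-monoˡ-≤)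
open import Data.Nat.Tactic.RingSolver using (solve-∀)
open import Data.Fin using (Fin; zero; suc)
open import Data.Fin.Properties using (_≟_; any?)
open import Data.Fin.Subset
  using (Subset; _∈_; _∉_; _⊆_; _∪_; _∩_; _─_; _-_; ⁅_⁆; ∣_∣; inside; outside)
open import Data.Fin.Subset.Properties
  using (_∈?_; drop-there; ⊆-antisym; p⊆q⇒∣p∣≤∣q∣; p⊂q⇒∣p∣<∣q∣; x∈p∪q⁻; x∈p∪q⁺; x∈⁅x⁆; x∈⁅y⁆⇒x≡y;
         x∈p∧x≢y⇒x∈p-y; p─q⊆p; p─⊥≡p; ∪-identityʳ; p∩q⊆q; x∈p∩q⁺; x∈p∩q⁻; p─x─y≡p─y─x)
open import Data.Vec using ([]; _∷_; here; there)
open import Data.List using (List; _∷_; length)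
open import Data.List.Relation.Unary.All as All using (All; []; _∷_)
open import Data.List.Relation.Unary.Any as Any using (Any)
open import Data.List.Relation.Unary.AllPairs using ([]; _∷_)
open import Data.List.Relation.Unary.Unique.Propositional using (Unique)
open import Data.Empty using (⊥)
open import Data.Unit using (tt)
open import Data.Product using (∃; ∃₂; _×_; _,_; proj₁; proj₂; swap)
open import Data.Sum using (_⊎_; inj₁; inj₂; map₂)
open import Function using (_∘_)
open import Relation.Nullary using (Dec; yes; no; ¬_; contradiction)
open import Relation.Nullary.Decidable using (_×-dec_; ¬?; decidable-stable)
open import Relation.Unary using (Pred; Decidable)
open import Relation.Binary.Definitions using (Symmetric)
open import Relation.Binary.PropositionalEquality
open import Algebra.Properties.Semiring.Sum +-*-semiring
  using (sum; sum-cong-≗; sum-replicate-zero; ∑-distrib-+; ∑-comm; *-distribˡ-sum; *-distribʳ-sum)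

private variable
  ℓ : Level
  A B C : Set ℓ
  n : ℕ
  x y : Fin n
  p q : Subset n

χ : ∀ {a} {A : Set a} → Dec A → ℕ
χ (yes _) = 1
χ (no _)  = 0

χ-yes : (A? : Dec A) → A → χ A? ≡ 1
χ-yes (yes _) _ = refl
χ-yes (no ¬a) a = contradiction a ¬a

χ-no : (A? : Dec A) → ¬ A → χ A? ≡ 0
χ-no (yes a) ¬a = contradiction a ¬a
χ-no (no _)  _  = refl

χ-mono : (A? : Dec A) (B? : Dec B) → (A → B) → χ A? ≤ χ B?
χ-mono (yes a) B? f = ≤-reflexive (sym (χ-yes B? (f a)))
χ-mono (no _)  _  _ = z≤n

χ-cong : (A? : Dec A) (B? : Dec B) → (A → B) → (B → A) → χ A? ≡ χ B?
χ-cong A? B? f g = ≤-antisym (χ-mono A? B? f) (χ-mono B? A? g)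

χ-split : (A? : Dec A) (B? : Dec B) → χ A? ≡ χ (A? ×-dec B?) + χ (A? ×-dec ¬? B?)
χ-split (yes _) (yes _) = refl
χ-split (yes _) (no _)  = refl
χ-split (no _)  _       = refl

χ-disjoint : (A? : Dec A) (B? : Dec B) (C? : Dec C) →
             (A → C) → (B → C) → (A → B → ⊥) → χ A? + χ B? ≤ χ C?
χ-disjoint (yes a) (yes b) _  _ _ disj = contradiction b (disj a)
χ-disjoint (yes a) (no _)  C? f _ _    = ≤-reflexive (sym (χ-yes C? (f a)))
χ-disjoint (no _)  B?      C? _ g _    = χ-mono B? C? g

sum-mono-≤ : {f g : Fin n → ℕ} → (∀ i → f i ≤ g i) → sum f ≤ sum g
sum-mono-≤ {zero}  _   = z≤n
sum-mono-≤ {suc n} f≤g = +-mono-≤ (f≤g zero) (sum-mono-≤ (f≤g ∘ suc))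

≤-sum : (f : Fin n → ℕ) (i : Fin n) → f i ≤ sum f
≤-sum f zero    = m≤m+n _ _
≤-sum f (suc i) = ≤-trans (≤-sum (f ∘ suc) i) (m≤n+m _ _)

+-≤-sum : (f : Fin n → ℕ) {i j : Fin n} → i ≢ j → f i + f j ≤ sum f
+-≤-sum f {zero}  {zero}  i≢j = contradiction refl i≢j
+-≤-sum f {zero}  {suc j} _   = +-monoʳ-≤ (f zero) (≤-sum (f ∘ suc) j)
+-≤-sum f {suc i} {zero}  _   = ≤-trans (≤-reflexive (+-comm (f (suc i)) (f zero)))
                                        (+-monoʳ-≤ (f zero) (≤-sum (f ∘ suc) i))
+-≤-sum f {suc i} {suc j} i≢j = ≤-trans (+-≤-sum (f ∘ suc) (i≢j ∘ cong suc)) (m≤n+m _ _)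

count : {P : Pred (Fin n) ℓ} → Decidable P → ℕ
count P? = sum (λ i → χ (P? i))

count-cong : {P Q : Pred (Fin n) ℓ} (P? : Decidable P) (Q? : Decidable Q) →
             (∀ {i} → P i → Q i) → (∀ {i} → Q i → P i) → count P? ≡ count Q?
count-cong P? Q? f g = sum-cong-≗ (λ i → χ-cong (P? i) (Q? i) f g)

∣p∣≡count∈ : ∀ {n} (p : Subset n) → ∣ p ∣ ≡ count (_∈? p)
∣p∣≡count∈ []            = refl
∣p∣≡count∈ (inside ∷ p)  = cong suc (trans (∣p∣≡count∈ p) (count-cong (_∈? p) (λ i → suc i ∈? _) there drop-there))
∣p∣≡count∈ (outside ∷ p) = trans (∣p∣≡count∈ p) (count-cong (_∈? p) (λ i → suc i ∈? _) there drop-there)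

count-none : {P : Pred (Fin n) ℓ} (P? : Decidable P) → (∀ i → ¬ P i) → count P? ≡ 0
count-none {n} P? none = trans (sum-cong-≗ (λ i → χ-no (P? i) (none i))) (sum-replicate-zero n)

count-split : {P Q : Pred (Fin n) ℓ} (P? : Decidable P) (Q? : Decidable Q) →
              count P? ≡ count (λ i → P? i ×-dec Q? i) + count (λ i → P? i ×-dec ¬? (Q? i))
count-split P? Q? = trans (sum-cong-≗ (λ i → χ-split (P? i) (Q? i)))
                          (∑-distrib-+ (λ i → χ (P? i ×-dec Q? i)) (λ i → χ (P? i ×-dec ¬? (Q? i))))

count-disjoint : {P Q R : Pred (Fin n) ℓ} (P? : Decidable P) (Q? : Decidable Q) (R? : Decidable R) →
                 (∀ {i} → P i → R i) → (∀ {i} → Q i → R i) → (∀ {i} → P i → Q i → ⊥) →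
                 count P? + count Q? ≤ count R?
count-disjoint P? Q? R? P⇒R Q⇒R disjoint = begin
  count P? + count Q?                 ≡⟨ ∑-distrib-+ (λ i → χ (P? i)) (λ i → χ (Q? i)) ⟨
  sum (λ i → χ (P? i) + χ (Q? i))     ≤⟨ sum-mono-≤ (λ i → χ-disjoint (P? i) (Q? i) (R? i) P⇒R Q⇒R disjoint) ⟩
  count R?                            ∎
  where open ≤-Reasoning

count₂ : {P : Fin n → Fin n → Set ℓ} → (∀ a → Decidable (P a)) → ℕ
count₂ P? = sum (λ a → count (P? a))

count₂-split : {P Q : Fin n → Fin n → Set ℓ} (P? : ∀ a → Decidable (P a)) (Q? : ∀ a → Decidable (Q a)) →
               count₂ P? ≡ count₂ (λ a b → P? a b ×-dec Q? a b) + count₂ (λ a b → P? a b ×-dec ¬? (Q? a b))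
count₂-split P? Q? = trans (sum-cong-≗ (λ a → count-split (P? a) (Q? a)))
  (∑-distrib-+ (λ a → count (λ b → P? a b ×-dec Q? a b)) (λ a → count (λ b → P? a b ×-dec ¬? (Q? a b))))

count₂-disjoint : {P Q R : Fin n → Fin n → Set ℓ}
                  (P? : ∀ a → Decidable (P a)) (Q? : ∀ a → Decidable (Q a)) (R? : ∀ a → Decidable (R a)) →
                  (∀ {a b} → P a b → R a b) → (∀ {a b} → Q a b → R a b) → (∀ {a b} → P a b → Q a b → ⊥) →
                  count₂ P? + count₂ Q? ≤ count₂ R?
count₂-disjoint P? Q? R? P⇒R Q⇒R disjoint =
  ≤-trans (≤-reflexive (sym (∑-distrib-+ (λ a → count (P? a)) (λ a → count (Q? a)))))
          (sum-mono-≤ (λ a → count-disjoint (P? a) (Q? a) (R? a) P⇒R Q⇒R disjoint))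

2≤count : {P : Pred (Fin n) ℓ} (P? : Decidable P) {i j : Fin n} → i ≢ j → P i → P j → 2 ≤ count P?
2≤count P? {i} {j} i≢j Pi Pj =
  ≤-trans (≤-reflexive (sym (cong₂ _+_ (χ-yes (P? i) Pi) (χ-yes (P? j) Pj)))) (+-≤-sum (λ k → χ (P? k)) i≢j)

2≤count₂ : {P : Fin n → Fin n → Set ℓ} (P? : ∀ a → Decidable (P a)) {a b : Fin n} →
           a ≢ b → P a b → P b a → 2 ≤ count₂ P?
2≤count₂ P? {a} {b} a≢b Pab Pba = begin
  2                               ≡⟨ cong₂ _+_ (χ-yes (P? a b) Pab) (χ-yes (P? b a) Pba) ⟨
  χ (P? a b) + χ (P? b a)         ≤⟨ +-mono-≤ (≤-sum (λ c → χ (P? a c)) b) (≤-sum (λ c → χ (P? b c)) a) ⟩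
  count (P? a) + count (P? b)     ≤⟨ +-≤-sum (λ c → count (P? c)) a≢b ⟩
  count₂ P?                       ∎
  where open ≤-Reasoning

module _ {ℓ} {n} {E : Fin n → Fin n → Set ℓ} (E? : ∀ a → Decidable (E a)) where

  degree : Fin n → ℕ
  degree a = count (E? a)

  leaf? : ∀ a → Dec (degree a ≡ 1)
  leaf? a = degree a ℕ.≟ 1

  leaves : ℕ
  leaves = count leaf?

  private
    Eˡ Eʳ : Fin n → Fin n → ℕ
    Eˡ a b = χ (E? a b) * χ (leaf? a)
    Eʳ a b = χ (E? a b) * χ (leaf? b)

    ∑degree·leaf≡leaves : sum (λ a → degree a * χ (leaf? a)) ≡ leaves
    ∑degree·leaf≡leaves = sum-cong-≗ degree·leaf
      where
      degree·leaf : ∀ a → degree a * χ (leaf? a) ≡ χ (leaf? a)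
      degree·leaf a with leaf? a
      ... | yes d≡1 = trans (*-identityʳ (degree a)) d≡1
      ... | no _    = *-zeroʳ (degree a)

    ∑∑Eˡ≡leaves : sum (λ a → sum (Eˡ a)) ≡ leaves
    ∑∑Eˡ≡leaves = trans (sum-cong-≗ (λ a → sym (*-distribʳ-sum (χ (leaf? a)) (λ b → χ (E? a b)))))
                        ∑degree·leaf≡leaves

    ∑∑Eʳ≡leaves : Symmetric E → sum (λ a → sum (Eʳ a)) ≡ leaves
    ∑∑Eʳ≡leaves E-sym = begin
      sum (λ a → sum (Eʳ a))                           ≡⟨ ∑-comm Eʳ ⟩
      sum (λ b → sum (λ a → χ (E? a b) * χ (leaf? b)))
        ≡⟨ sum-cong-≗ (λ b → *-distribʳ-sum (χ (leaf? b)) (λ a → χ (E? a b))) ⟨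
      sum (λ b → count (λ a → E? a b) * χ (leaf? b))
        ≡⟨ sum-cong-≗ (λ b → cong (_* χ (leaf? b)) (count-cong _ (E? b) E-sym E-sym)) ⟩
      sum (λ b → degree b * χ (leaf? b))               ≡⟨ ∑degree·leaf≡leaves ⟩
      leaves                                           ∎
      where open ≡-Reasoning

  -- Summing [a is a leaf] + [b is a leaf] over the edges (a, b) gives 2 · leaves, and every
  -- summand is at most 1.
  2*leaves≤count₂ : Symmetric E → (∀ {a b} → E a b → degree a ≡ 1 → degree b ≡ 1 → ⊥) →
                    2 * leaves ≤ count₂ E?
  2*leaves≤count₂ E-sym no-leaf-edge = begin
    2 * leaves                                         ≡⟨ cong (leaves +_) (+-identityʳ leaves) ⟩
    leaves + leaves                                    ≡⟨ cong₂ _+_ ∑∑Eˡ≡leaves (∑∑Eʳ≡leaves E-sym) ⟨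
    sum (λ a → sum (Eˡ a)) + sum (λ a → sum (Eʳ a))    ≡⟨ ∑-distrib-+ (λ a → sum (Eˡ a)) (λ a → sum (Eʳ a)) ⟨
    sum (λ a → sum (Eˡ a) + sum (Eʳ a))                ≡⟨ sum-cong-≗ (λ a → ∑-distrib-+ (Eˡ a) (Eʳ a)) ⟨
    sum (λ a → sum (λ b → Eˡ a b + Eʳ a b))
                                                       ≡⟨ sum-cong-≗ (λ a → sum-cong-≗ (λ b → *-distribˡ-+ (χ (E? a b)) _ _)) ⟨
    sum (λ a → sum (λ b → χ (E? a b) * (χ (leaf? a) + χ (leaf? b))))
                                                       ≤⟨ sum-mono-≤ (λ a → sum-mono-≤ (edge-bound a)) ⟩
    count₂ E?                                          ∎
    where
    open ≤-Reasoning
    edge-bound : ∀ a b → χ (E? a b) * (χ (leaf? a) + χ (leaf? b)) ≤ χ (E? a b)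
    edge-bound a b with E? a b
    ... | no _    = z≤n
    ... | yes eab = ≤-trans (≤-reflexive (+-identityʳ _))
                            (χ-disjoint (leaf? a) (leaf? b) (yes tt) _ _ (no-leaf-edge eab))

  2*count≤count₂+leaves : ∀ {ℓ′} {V : Pred (Fin n) ℓ′} (V? : Decidable V) →
                          (∀ {a} → V a → 1 ≤ degree a) → 2 * count V? ≤ count₂ E? + leaves
  2*count≤count₂+leaves V? deg≥1 = begin
    2 * count V?                          ≡⟨ *-distribˡ-sum 2 (λ a → χ (V? a)) ⟩
    sum (λ a → 2 * χ (V? a))              ≤⟨ sum-mono-≤ vertex-bound ⟩
    sum (λ a → degree a + χ (leaf? a))    ≡⟨ ∑-distrib-+ degree (λ a → χ (leaf? a)) ⟩
    count₂ E? + leaves                    ∎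
    where
    open ≤-Reasoning
    vertex-bound : ∀ a → 2 * χ (V? a) ≤ degree a + χ (leaf? a)
    vertex-bound a with V? a | leaf? a
    ... | no _  | _       = z≤n
    ... | yes _ | yes d≡1 = ≤-reflexive (cong (_+ 1) (sym d≡1))
    ... | yes v | no d≢1  = ≤-trans (≤∧≢⇒< (deg≥1 v) (d≢1 ∘ sym)) (m≤m+n (degree a) 0)

  -- A graph on V without isolated vertices and without an edge between two leaves
  -- has at least 2|V|/3 edges; count₂ counts every edge twice.
  4*count≤3*count₂ : Symmetric E → ∀ {ℓ′} {V : Pred (Fin n) ℓ′} (V? : Decidable V) →
                     (∀ {a} → V a → 1 ≤ degree a) →
                     (∀ {a b} → E a b → degree a ≡ 1 → degree b ≡ 1 → ⊥) →
                     4 * count V? ≤ 3 * count₂ E?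
  4*count≤3*count₂ E-sym V? deg≥1 no-leaf-edge = begin
    4 * count V?                   ≡⟨ *-assoc 2 2 (count V?) ⟩
    2 * (2 * count V?)             ≤⟨ *-monoʳ-≤ 2 (2*count≤count₂+leaves V? deg≥1) ⟩
    2 * (count₂ E? + leaves)       ≡⟨ *-distribˡ-+ 2 (count₂ E?) leaves ⟩
    2 * count₂ E? + 2 * leaves     ≤⟨ +-monoʳ-≤ (2 * count₂ E?) (2*leaves≤count₂ E-sym no-leaf-edge) ⟩
    2 * count₂ E? + count₂ E?      ≡⟨ +-comm (2 * count₂ E?) (count₂ E?) ⟩
    3 * count₂ E?                  ∎
    where open ≤-Reasoning

x∈p─q⇒x∉q : ∀ (p q : Subset n) → x ∈ p ─ q → x ∉ q
x∈p─q⇒x∉q (_ ∷ p) (outside ∷ q) here        ()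
x∈p─q⇒x∉q (_ ∷ p) (_       ∷ q) (there x∈) (there x∈q) = x∈p─q⇒x∉q p q x∈ x∈q

x∈p-y⁻ : x ∈ p - y → x ∈ p × x ≢ y
x∈p-y⁻ {p = p} {y} x∈ = p─q⊆p p ⁅ y ⁆ x∈ , λ { refl → x∈p─q⇒x∉q p ⁅ y ⁆ x∈ (x∈⁅x⁆ y) }

x∈p∪⁅y⁆⁻ : x ∈ p ∪ ⁅ y ⁆ → x ∈ p ⊎ x ≡ y
x∈p∪⁅y⁆⁻ {p = p} {y} x∈ = map₂ (x∈⁅y⁆⇒x≡y y) (x∈p∪q⁻ p ⁅ y ⁆ x∈)

x∈p∪⁅y⁆⁺ : x ∈ p ⊎ x ≡ y → x ∈ p ∪ ⁅ y ⁆
x∈p∪⁅y⁆⁺         (inj₁ x∈p)  = x∈p∪q⁺ (inj₁ x∈p)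
x∈p∪⁅y⁆⁺ {p = p} (inj₂ refl) = x∈p∪q⁺ {p = p} (inj₂ (x∈⁅x⁆ _))

x∉p⇒∣p∪⁅x⁆∣≡suc∣p∣ : x ∉ p → ∣ p ∪ ⁅ x ⁆ ∣ ≡ suc ∣ p ∣
x∉p⇒∣p∪⁅x⁆∣≡suc∣p∣ {x = zero}  {inside  ∷ p} x∉p = contradiction here x∉p
x∉p⇒∣p∪⁅x⁆∣≡suc∣p∣ {x = zero}  {outside ∷ p} _   = cong (suc ∘ ∣_∣) (∪-identityʳ p)
x∉p⇒∣p∪⁅x⁆∣≡suc∣p∣ {x = suc x} {inside  ∷ p} x∉p = cong suc (x∉p⇒∣p∪⁅x⁆∣≡suc∣p∣ (x∉p ∘ there))
x∉p⇒∣p∪⁅x⁆∣≡suc∣p∣ {x = suc x} {outside ∷ p} x∉p = x∉p⇒∣p∪⁅x⁆∣≡suc∣p∣ (x∉p ∘ there)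

x∈p⇒suc∣p-x∣≡∣p∣ : x ∈ p → suc ∣ p - x ∣ ≡ ∣ p ∣
x∈p⇒suc∣p-x∣≡∣p∣ {p = inside  ∷ p} here        = cong (suc ∘ ∣_∣) (p─⊥≡p p)
x∈p⇒suc∣p-x∣≡∣p∣ {p = inside  ∷ p} (there x∈p) = cong suc (x∈p⇒suc∣p-x∣≡∣p∣ x∈p)
x∈p⇒suc∣p-x∣≡∣p∣ {p = outside ∷ p} (there x∈p) = x∈p⇒suc∣p-x∣≡∣p∣ x∈p

p⊆q∧∣q∣≤∣p∣⇒p≡q : p ⊆ q → ∣ q ∣ ≤ ∣ p ∣ → p ≡ q
p⊆q∧∣q∣≤∣p∣⇒p≡q {p = p} {q} p⊆q ∣q∣≤∣p∣ = ⊆-antisym p⊆q q⊆p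
  where
  q⊆p : q ⊆ p
  q⊆p {x} x∈q with x ∈? p
  ... | yes x∈p = x∈p
  ... | no  x∉p = contradiction ∣q∣≤∣p∣ (<⇒≱ (p⊂q⇒∣p∣<∣q∣ (p⊆q , x , x∈q , x∉p)))

p⊆q∧∣p∣<∣q∣⇒∃∈q∖p : p ⊆ q → ∣ p ∣ < ∣ q ∣ → ∃ λ x → x ∈ q × x ∉ p
p⊆q∧∣p∣<∣q∣⇒∃∈q∖p {p = p} {q} p⊆q ∣p∣<∣q∣ with any? (λ x → (x ∈? q) ×-dec ¬? (x ∈? p))
... | yes new = new
... | no none  = contradiction (p⊆q⇒∣p∣≤∣q∣ q⊆p) (<⇒≱ ∣p∣<∣q∣)
  where
  q⊆p : q ⊆ p
  q⊆p {x} x∈q with x ∈? p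
  ... | yes x∈p = x∈p
  ... | no  x∉p = contradiction (x , x∈q , x∉p) none

p⊆q∧suc∣p∣≡∣q∣⇒p≡q-x : p ⊆ q → suc ∣ p ∣ ≡ ∣ q ∣ → ∃ λ x → x ∈ q × p ≡ q - x
p⊆q∧suc∣p∣≡∣q∣⇒p≡q-x {p = p} {q} p⊆q ∣q∣≡ with p⊆q∧∣p∣<∣q∣⇒∃∈q∖p p⊆q (≤-reflexive ∣q∣≡)
... | x , x∈q , x∉p = x , x∈q , p⊆q∧∣q∣≤∣p∣⇒p≡q p⊆q-x (≤-reflexive (suc-injective ∣q-x∣≡))
  where
  p⊆q-x : p ⊆ q - x
  p⊆q-x y∈p = x∈p∧x≢y⇒x∈p-y (p⊆q y∈p) λ { refl → x∉p y∈p }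
  ∣q-x∣≡ : suc ∣ q - x ∣ ≡ suc ∣ p ∣
  ∣q-x∣≡ = trans (x∈p⇒suc∣p-x∣≡∣p∣ x∈q) (sym ∣q∣≡)

module _ {n} {k : ℕ} {H : Hypergraph n} where

  decomposition⇒friend : ∀ {Q Y w} → Decomposition (suc k) H Q → Y ⊆ Q → w ∈ Q → w ∉ Y →
                         IsFriend (suc k) H Y w
  decomposition⇒friend {Q} {Y} {w} (_ , Q-edges) Y⊆Q w∈Q w∉Y = w∉Y , λ B B⊆Y ∣B∣≡k →
    Q-edges (B ∪ ⁅ w ⁆) (B∪⁅w⁆⊆Q B⊆Y)
            (trans (x∉p⇒∣p∪⁅x⁆∣≡suc∣p∣ (λ w∈B → w∉Y (B⊆Y w∈B))) (cong suc ∣B∣≡k))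
    where
    B∪⁅w⁆⊆Q : ∀ {B} → B ⊆ Y → B ∪ ⁅ w ⁆ ⊆ Q
    B∪⁅w⁆⊆Q B⊆Y x∈ with x∈p∪⁅y⁆⁻ x∈
    ... | inj₁ x∈B  = Y⊆Q (B⊆Y x∈B)
    ... | inj₂ refl = w∈Q

  module _ (friendship : IsFriendshipHypergraph (suc k) H) where

    friend-unique : ∀ {Y u v} → ∣ Y ∣ ≡ suc k → IsFriend (suc k) H Y u → IsFriend (suc k) H Y v → u ≡ v
    friend-unique {Y} ∣Y∣≡r u-friend v-friend with proj₂ friendship Y ∣Y∣≡r
    ... | _ , _ , unique = trans (unique _ u-friend) (sym (unique _ v-friend))

    -- An r-set Y inside Q ∈ H′ is Q minus one vertex, which is then the unique friend of Y.
    decomposition-unique : ∀ {Q₁ Q₂ Y} → Decomposition (suc k) H Q₁ → Decomposition (suc k) H Q₂ →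
                           ∣ Y ∣ ≡ suc k → Y ⊆ Q₁ → Y ⊆ Q₂ → Q₁ ≡ Q₂
    decomposition-unique {Q₁} {Q₂} {Y} dQ₁ dQ₂ ∣Y∣≡r Y⊆Q₁ Y⊆Q₂
      with p⊆q∧suc∣p∣≡∣q∣⇒p≡q-x Y⊆Q₁ (trans (cong suc ∣Y∣≡r) (sym (proj₁ dQ₁)))
         | p⊆q∧suc∣p∣≡∣q∣⇒p≡q-x Y⊆Q₂ (trans (cong suc ∣Y∣≡r) (sym (proj₁ dQ₂)))
    ... | w₁ , w₁∈Q₁ , refl | w₂ , w₂∈Q₂ , Y≡Q₂-w₂ =
      p⊆q∧∣q∣≤∣p∣⇒p≡q Q₁⊆Q₂ (≤-reflexive (trans (proj₁ dQ₂) (sym (proj₁ dQ₁))))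
      where
      w₁≡w₂ : w₁ ≡ w₂
      w₁≡w₂ = friend-unique ∣Y∣≡r
        (decomposition⇒friend dQ₁ Y⊆Q₁ w₁∈Q₁ (λ w₁∈ → proj₂ (x∈p-y⁻ w₁∈) refl))
        (decomposition⇒friend dQ₂ Y⊆Q₂ w₂∈Q₂ (λ w₂∈ → proj₂ (x∈p-y⁻ (subst (w₂ ∈_) Y≡Q₂-w₂ w₂∈)) refl))
      Q₁⊆Q₂ : Q₁ ⊆ Q₂
      Q₁⊆Q₂ {x} x∈Q₁ with x ≟ w₁
      ... | yes refl = subst (_∈ Q₂) (sym w₁≡w₂) w₂∈Q₂
      ... | no  x≢w₁ = Y⊆Q₂ (x∈p∧x≢y⇒x∈p-y x∈Q₁ x≢w₁)

-- The uniformity r is written suc k, so that r ∸ 1 is k.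
module AroundHyperedge {n} {k : ℕ} {H : Hypergraph n} (friendship : IsFriendshipHypergraph (suc k) H)
                       {q : Subset n} (dq : Decomposition (suc k) H q) {z : Fin n} (z∉q : z ∉ q) where

  Good : Subset n → Set
  Good q′ = Decomposition (suc k) H q′ × z ∈ q′ × ∣ q′ ∩ q ∣ ≡ k

  Y : Fin n → Fin n → Subset n
  Y a b = (q - a - b) ∪ ⁅ z ⁆

  ∈q-a-b⁻ : ∀ {x a b} → x ∈ q - a - b → x ∈ q × x ≢ a × x ≢ b
  ∈q-a-b⁻ x∈ = let x∈q-a , x≢b = x∈p-y⁻ x∈ ; x∈q , x≢a = x∈p-y⁻ x∈q-a in x∈q , x≢a , x≢b

  ∈q-a-b⁺ : ∀ {x a b} → x ∈ q → x ≢ a → x ≢ b → x ∈ q - a - b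
  ∈q-a-b⁺ x∈q x≢a x≢b = x∈p∧x≢y⇒x∈p-y (x∈p∧x≢y⇒x∈p-y x∈q x≢a) x≢b

  ∣q-a∣≡r : ∀ {a} → a ∈ q → ∣ q - a ∣ ≡ suc k
  ∣q-a∣≡r a∈q = suc-injective (trans (x∈p⇒suc∣p-x∣≡∣p∣ a∈q) (proj₁ dq))

  Pair : Fin n → Fin n → Set
  Pair a b = a ∈ q × b ∈ q - a

  Pair-sym : ∀ {a b} → Pair a b → Pair b a
  Pair-sym (a∈q , b∈q-a) with x∈p-y⁻ b∈q-a
  ... | b∈q , b≢a = b∈q , x∈p∧x≢y⇒x∈p-y a∈q (λ a≡b → b≢a (sym a≡b))

  Pair⇒≢ : ∀ {a b} → Pair a b → a ≢ b
  Pair⇒≢ ab = proj₂ (x∈p-y⁻ (proj₂ (Pair-sym ab)))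

  Y-sym : ∀ a b → Y a b ≡ Y b a
  Y-sym a b = cong (_∪ ⁅ z ⁆) (p─x─y≡p─y─x q a b)

  ∣q-a-b∣≡r-1 : ∀ {a b} → Pair a b → ∣ q - a - b ∣ ≡ k
  ∣q-a-b∣≡r-1 (a∈q , b∈q-a) = suc-injective (trans (x∈p⇒suc∣p-x∣≡∣p∣ b∈q-a) (∣q-a∣≡r a∈q))

  ∣Y∣≡r : ∀ {a b} → Pair a b → ∣ Y a b ∣ ≡ suc k
  ∣Y∣≡r {a} {b} ab = trans (x∉p⇒∣p∪⁅x⁆∣≡suc∣p∣ {p = q - a - b} (λ z∈ → z∉q (proj₁ (∈q-a-b⁻ z∈))))
                           (cong suc (∣q-a-b∣≡r-1 ab))

  good-misses-pair : ∀ {q′} → Good q′ → ∃₂ λ a b → Pair a b × a ∉ q′ × b ∉ q′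
  good-misses-pair {q′} (_ , _ , ∣q′∩q∣≡k)
    with p⊆q∧∣p∣<∣q∣⇒∃∈q∖p (p∩q⊆q q′ q) (subst₂ _<_ (sym ∣q′∩q∣≡k) (sym (proj₁ dq)) (s≤s (n≤1+n k)))
  ... | a , a∈q , a∉q′∩q
    with p⊆q∧∣p∣<∣q∣⇒∃∈q∖p {p = (q′ ∩ q) ∪ ⁅ a ⁆} {q} ⊆q
           (subst₂ _<_ (sym (trans (x∉p⇒∣p∪⁅x⁆∣≡suc∣p∣ a∉q′∩q) (cong suc ∣q′∩q∣≡k))) (sym (proj₁ dq)) ≤-refl)
    where
    ⊆q : (q′ ∩ q) ∪ ⁅ a ⁆ ⊆ q
    ⊆q x∈ with x∈p∪⁅y⁆⁻ x∈
    ... | inj₁ x∈q′∩q = p∩q⊆q q′ q x∈q′∩q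
    ... | inj₂ refl   = a∈q
  ... | b , b∈q , b∉ = a , b , (a∈q , x∈p∧x≢y⇒x∈p-y b∈q (λ { refl → b∉ (x∈p∪⁅y⁆⁺ (inj₂ refl)) }))
                     , (λ a∈q′ → a∉q′∩q (x∈p∩q⁺ (a∈q′ , a∈q)))
                     , (λ b∈q′ → b∉ (x∈p∪⁅y⁆⁺ (inj₁ (x∈p∩q⁺ (b∈q′ , b∈q)))))

  Y⊆good : ∀ {q′ a b} → Good q′ → Pair a b → a ∉ q′ → b ∉ q′ → Y a b ⊆ q′
  Y⊆good {q′} {a} {b} (_ , z∈q′ , ∣q′∩q∣≡k) ab a∉q′ b∉q′ x∈Y with x∈p∪⁅y⁆⁻ x∈Y
  ... | inj₂ refl     = z∈q′
  ... | inj₁ x∈q-a-b = proj₁ (x∈p∩q⁻ q′ q (subst (_ ∈_) (sym q′∩q≡q-a-b) x∈q-a-b))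
    where
    q′∩q⊆q-a-b : q′ ∩ q ⊆ q - a - b
    q′∩q⊆q-a-b x∈ with x∈p∩q⁻ q′ q x∈
    ... | x∈q′ , x∈q = ∈q-a-b⁺ x∈q (λ { refl → a∉q′ x∈q′ }) (λ { refl → b∉q′ x∈q′ })
    q′∩q≡q-a-b : q′ ∩ q ≡ q - a - b
    q′∩q≡q-a-b = p⊆q∧∣q∣≤∣p∣⇒p≡q q′∩q⊆q-a-b (≤-reflexive (trans (∣q-a-b∣≡r-1 ab) (sym ∣q′∩q∣≡k)))

  Y∈H : ∀ {q′ a b} → Good q′ → Pair a b → a ∉ q′ → b ∉ q′ → H (Y a b)
  Y∈H good ab a∉q′ b∉q′ = proj₂ (proj₁ good) _ (Y⊆good good ab a∉q′ b∉q′) (∣Y∣≡r ab)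

  good-unique : ∀ {q₁ q₂ a b} → Good q₁ → Good q₂ → Pair a b →
                a ∉ q₁ → b ∉ q₁ → a ∉ q₂ → b ∉ q₂ → q₁ ≡ q₂
  good-unique good₁ good₂ ab a∉q₁ b∉q₁ a∉q₂ b∉q₂ =
    decomposition-unique friendship (proj₁ good₁) (proj₁ good₂) (∣Y∣≡r ab)
      (Y⊆good good₁ ab a∉q₁ b∉q₁) (Y⊆good good₂ ab a∉q₂ b∉q₂)

  -- If all Y a b were hyperedges, z would be a second friend of q - a besides a.
  vertex-has-non-edge : ∀ {a} → a ∈ q → ¬ (∀ {b} → b ∈ q - a → H (Y a b))
  vertex-has-non-edge {a} a∈q all-edges = z∉q (subst (_∈ q) (sym z≡a) a∈q)
    where
    z≡a : z ≡ a
    z≡a = friend-unique friendship (∣q-a∣≡r a∈q) z-friend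
      (decomposition⇒friend dq (p─q⊆p q ⁅ a ⁆) a∈q (λ a∈ → proj₂ (x∈p-y⁻ a∈) refl))
      where
      z-friend : IsFriend (suc k) H (q - a) z
      z-friend = (λ z∈ → z∉q (proj₁ (x∈p-y⁻ z∈))) , edges
        where
        edges : ∀ B → B ⊆ q - a → ∣ B ∣ ≡ k → H (B ∪ ⁅ z ⁆)
        edges B B⊆q-a ∣B∣≡k with p⊆q∧suc∣p∣≡∣q∣⇒p≡q-x B⊆q-a (trans (cong suc ∣B∣≡k) (sym (∣q-a∣≡r a∈q)))
        ... | b , b∈q-a , refl = all-edges b∈q-a

  -- The (r - 1)-subsets of Y a b are Y a b minus z, which together with a lie in q,
  -- and Y a b minus some c ∈ q - a - b, which together with a form Y b c.
  friend-of-Y : ∀ {a b} → Pair a b → (∀ {c} → c ∈ q - a - b → H (Y b c)) → IsFriend (suc k) H (Y a b) a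
  friend-of-Y {a} {b} ab@(a∈q , b∈q-a) edges = a∉Y , B∪⁅a⁆∈H
    where
    a∉Y : a ∉ Y a b
    a∉Y a∈ with x∈p∪⁅y⁆⁻ a∈
    ... | inj₁ a∈q-a-b = proj₁ (proj₂ (∈q-a-b⁻ a∈q-a-b)) refl
    ... | inj₂ refl    = z∉q a∈q

    ∣B∪⁅a⁆∣≡r : ∀ {B} → B ⊆ Y a b → ∣ B ∣ ≡ k → ∣ B ∪ ⁅ a ⁆ ∣ ≡ suc k
    ∣B∪⁅a⁆∣≡r {B} B⊆Y ∣B∣≡k = trans (x∉p⇒∣p∪⁅x⁆∣≡suc∣p∣ {p = B} (λ a∈B → a∉Y (B⊆Y a∈B))) (cong suc ∣B∣≡k)

    B∪⁅a⁆∈H : ∀ B → B ⊆ Y a b → ∣ B ∣ ≡ k → H (B ∪ ⁅ a ⁆)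
    B∪⁅a⁆∈H B B⊆Y ∣B∣≡k with p⊆q∧suc∣p∣≡∣q∣⇒p≡q-x B⊆Y (trans (cong suc ∣B∣≡k) (sym (∣Y∣≡r ab)))
    ... | y , y∈Y , refl with x∈p∪⁅y⁆⁻ y∈Y
    ...   | inj₂ refl    = proj₂ dq _ ⊆q (∣B∪⁅a⁆∣≡r B⊆Y ∣B∣≡k)
      where
      ⊆q : (Y a b - z) ∪ ⁅ a ⁆ ⊆ q
      ⊆q x∈ with x∈p∪⁅y⁆⁻ x∈
      ... | inj₂ refl = a∈q
      ... | inj₁ x∈Y-z with x∈p-y⁻ x∈Y-z
      ...   | x∈Y , x≢z with x∈p∪⁅y⁆⁻ x∈Y
      ...     | inj₁ x∈q-a-b = proj₁ (∈q-a-b⁻ x∈q-a-b)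
      ...     | inj₂ x≡z     = contradiction x≡z x≢z
    ...   | inj₁ c∈q-a-b = subst H (sym B∪⁅a⁆≡Ybc) (edges c∈q-a-b)
      where
      c = y
      bc : Pair b c
      bc = let c∈q , _ , c≢b = ∈q-a-b⁻ c∈q-a-b in proj₁ (Pair-sym ab) , x∈p∧x≢y⇒x∈p-y c∈q c≢b
      a≢c : a ≢ c
      a≢c a≡c = proj₁ (proj₂ (∈q-a-b⁻ c∈q-a-b)) (sym a≡c)
      ⊆Ybc : (Y a b - c) ∪ ⁅ a ⁆ ⊆ Y b c
      ⊆Ybc x∈ with x∈p∪⁅y⁆⁻ x∈
      ... | inj₂ refl = x∈p∪⁅y⁆⁺ (inj₁ (∈q-a-b⁺ a∈q (Pair⇒≢ ab) a≢c))
      ... | inj₁ x∈Y-c with x∈p-y⁻ x∈Y-c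
      ...   | x∈Y , x≢c with x∈p∪⁅y⁆⁻ x∈Y
      ...     | inj₁ x∈q-a-b = let x∈q , _ , x≢b = ∈q-a-b⁻ x∈q-a-b in x∈p∪⁅y⁆⁺ (inj₁ (∈q-a-b⁺ x∈q x≢b x≢c))
      ...     | inj₂ x≡z     = x∈p∪⁅y⁆⁺ (inj₂ x≡z)
      B∪⁅a⁆≡Ybc : (Y a b - c) ∪ ⁅ a ⁆ ≡ Y b c
      B∪⁅a⁆≡Ybc = p⊆q∧∣q∣≤∣p∣⇒p≡q ⊆Ybc (≤-reflexive (trans (∣Y∣≡r bc) (sym (∣B∪⁅a⁆∣≡r B⊆Y ∣B∣≡k))))

  pair-has-non-edge : ∀ {a b} → Pair a b → ¬ (∀ {c} → c ∈ q - a - b → H (Y a c) × H (Y b c))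
  pair-has-non-edge {a} {b} ab all-edges = Pair⇒≢ ab a≡b
    where
    a≡b : a ≡ b
    a≡b = friend-unique friendship (∣Y∣≡r ab)
      (friend-of-Y ab (λ c∈ → proj₂ (all-edges c∈)))
      (subst (λ Y′ → IsFriend (suc k) H Y′ b) (Y-sym b a)
        (friend-of-Y (Pair-sym ab) (λ c∈ → proj₁ (all-edges (subst (_ ∈_) (p─x─y≡p─y─x q b a) c∈)))))

  Pair? : ∀ a → Decidable (Pair a)
  Pair? a b = (a ∈? q) ×-dec (b ∈? q - a)

  MissedBy : List (Subset n) → Fin n → Fin n → Set
  MissedBy xs a b = Any (λ q′ → a ∉ q′ × b ∉ q′) xs

  MissedBy? : ∀ xs a → Decidable (MissedBy xs a)
  MissedBy? xs a b = Any.any? (λ q′ → ¬? (a ∈? q′) ×-dec ¬? (b ∈? q′)) xs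

  count₂-Pair : count₂ Pair? ≡ suc (suc k) * suc k
  count₂-Pair = begin
    count₂ Pair?                     ≡⟨ sum-cong-≗ row ⟩
    sum (λ a → χ (a ∈? q) * suc k)   ≡⟨ *-distribʳ-sum (suc k) (λ a → χ (a ∈? q)) ⟨
    count (_∈? q) * suc k            ≡⟨ cong (_* suc k) (trans (sym (∣p∣≡count∈ q)) (proj₁ dq)) ⟩
    suc (suc k) * suc k              ∎
    where
    open ≡-Reasoning
    row : ∀ a → count (Pair? a) ≡ χ (a ∈? q) * suc k
    row a = row′ (a ∈? q)
      where
      row′ : (a∈?q : Dec (a ∈ q)) → count (Pair? a) ≡ χ a∈?q * suc k
      row′ (yes a∈q) = trans (count-cong (Pair? a) (_∈? q - a) proj₂ (a∈q ,_))
                             (trans (sym (∣p∣≡count∈ (q - a))) (trans (∣q-a∣≡r a∈q) (sym (+-identityʳ _))))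
      row′ (no a∉q)  = count-none (Pair? a) (λ b ab → a∉q (proj₁ ab))

  Covered? : ∀ xs a → Decidable (λ b → Pair a b × MissedBy xs a b)
  Covered?   xs a b = Pair? a b ×-dec MissedBy? xs a b

  Uncovered : List (Subset n) → Fin n → Fin n → Set
  Uncovered xs a b = Pair a b × ¬ MissedBy xs a b

  Uncovered? : ∀ xs a → Decidable (Uncovered xs a)
  Uncovered? xs a b = Pair? a b ×-dec ¬? (MissedBy? xs a b)

  missed⇒Y∈H : ∀ {xs a b} → All Good xs → Pair a b → MissedBy xs a b → H (Y a b)
  missed⇒Y∈H goods ab = All.lookupWith (λ good (a∉ , b∉) → Y∈H good ab a∉ b∉) goods

  -- Distinct good hyperedges miss distinct pairs, and each misses a pair in both orders.
  2*length≤count₂-Covered : ∀ {xs} → Unique xs → All Good xs → 2 * length xs ≤ count₂ (Covered? xs)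
  2*length≤count₂-Covered [] [] = z≤n
  2*length≤count₂-Covered {x ∷ xs} (x∉xs ∷ unique) (good ∷ goods) = begin
    2 * suc (length xs)                 ≡⟨ *-suc 2 (length xs) ⟩
    2 + 2 * length xs                   ≤⟨ +-mono-≤ misses-two (2*length≤count₂-Covered unique goods) ⟩
    count₂ Missed-by-x? + count₂ (Covered? xs)
                                        ≤⟨ count₂-disjoint Missed-by-x? (Covered? xs) (Covered? (x ∷ xs))
                                             (λ (ab , m) → ab , Any.here m) (λ (ab , m) → ab , Any.there m)
                                             disjoint ⟩
    count₂ (Covered? (x ∷ xs))          ∎
    where
    open ≤-Reasoning
    Missed-by-x? : ∀ a → Decidable (λ b → Pair a b × a ∉ x × b ∉ x)
    Missed-by-x? a b = Pair? a b ×-dec (¬? (a ∈? x) ×-dec ¬? (b ∈? x))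
    misses-two : 2 ≤ count₂ Missed-by-x?
    misses-two with good-misses-pair good
    ... | a , b , ab , a∉x , b∉x =
      2≤count₂ Missed-by-x? (Pair⇒≢ ab) (ab , a∉x , b∉x) (Pair-sym ab , b∉x , a∉x)
    disjoint : ∀ {a b} → Pair a b × a ∉ x × b ∉ x → Pair a b × MissedBy xs a b → ⊥
    disjoint (ab , a∉x , b∉x) (_ , missed) with All.lookupAny (All.zip (goods , x∉xs)) missed
    ... | (good′ , x≢x′) , a∉x′ , b∉x′ = x≢x′ (good-unique good good′ ab a∉x b∉x a∉x′ b∉x′)

  4*∣q∣≤3*count₂-Uncovered : ∀ {xs} → All Good xs → 4 * suc (suc k) ≤ 3 * count₂ (Uncovered? xs)
  4*∣q∣≤3*count₂-Uncovered {xs} goods =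
    subst (λ m → 4 * m ≤ 3 * count₂ (Uncovered? xs)) (trans (sym (∣p∣≡count∈ q)) (proj₁ dq))
      (4*count≤3*count₂ (Uncovered? xs) Uncovered-sym (_∈? q) degree≥1 no-leaf-edge)
    where
    Uncovered-sym : ∀ {a b} → Uncovered xs a b → Uncovered xs b a
    Uncovered-sym (ab , ¬missed) = Pair-sym ab , λ missed → ¬missed (Any.map swap missed)

    covered⇒Y∈H : ∀ {a b} → Pair a b → ¬ Uncovered xs a b → H (Y a b)
    covered⇒Y∈H {a} {b} ab ¬uncovered =
      missed⇒Y∈H goods ab (decidable-stable (MissedBy? xs a b) (λ ¬missed → ¬uncovered (ab , ¬missed)))

    degree≥1 : ∀ {a} → a ∈ q → 1 ≤ degree (Uncovered? xs) a
    degree≥1 {a} a∈q with any? (Uncovered? xs a)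
    ... | yes (b , uncovered) = ≤-trans (≤-reflexive (sym (χ-yes (Uncovered? xs a b) uncovered)))
                                        (≤-sum (λ c → χ (Uncovered? xs a c)) b)
    ... | no none = contradiction (λ {b} b∈q-a → covered⇒Y∈H (a∈q , b∈q-a) (λ u → none (_ , u)))
                                  (vertex-has-non-edge a∈q)

    ¬uncovered-at-leaf : ∀ {a b c} → Uncovered xs a b → degree (Uncovered? xs) a ≡ 1 → c ≢ b →
                         ¬ Uncovered xs a c
    ¬uncovered-at-leaf {a} ab leaf c≢b ac =
      <-irrefl refl (subst (2 ≤_) leaf (2≤count (Uncovered? xs a) (λ b≡c → c≢b (sym b≡c)) ab ac))

    no-leaf-edge : ∀ {a b} → Uncovered xs a b →
                   degree (Uncovered? xs) a ≡ 1 → degree (Uncovered? xs) b ≡ 1 → ⊥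
    no-leaf-edge {a} {b} uab@(ab , _) leaf-a leaf-b = pair-has-non-edge ab λ {c} c∈q-a-b →
      let c∈q , c≢a , c≢b = ∈q-a-b⁻ c∈q-a-b in
      covered⇒Y∈H (proj₁ ab , x∈p∧x≢y⇒x∈p-y c∈q c≢a) (¬uncovered-at-leaf uab leaf-a c≢b) ,
      covered⇒Y∈H (proj₁ (Pair-sym ab) , x∈p∧x≢y⇒x∈p-y c∈q c≢b)
                  (¬uncovered-at-leaf (Uncovered-sym uab) leaf-b c≢a)

  6*length+4*∣q∣≤3*pairs : ∀ {xs} → Unique xs → All Good xs →
                            6 * length xs + 4 * suc (suc k) ≤ 3 * (suc (suc k) * suc k)
  6*length+4*∣q∣≤3*pairs {xs} unique goods = begin
    6 * length xs + 4 * suc (suc k)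
      ≡⟨ cong (_+ 4 * suc (suc k)) (*-assoc 3 2 (length xs)) ⟩
    3 * (2 * length xs) + 4 * suc (suc k)
      ≤⟨ +-mono-≤ (*-monoʳ-≤ 3 (2*length≤count₂-Covered unique goods)) (4*∣q∣≤3*count₂-Uncovered goods) ⟩
    3 * count₂ (Covered? xs) + 3 * count₂ (Uncovered? xs)
      ≡⟨ *-distribˡ-+ 3 (count₂ (Covered? xs)) (count₂ (Uncovered? xs)) ⟨
    3 * (count₂ (Covered? xs) + count₂ (Uncovered? xs))
      ≡⟨ cong (3 *_) (count₂-split Pair? (MissedBy? xs)) ⟨
    3 * count₂ Pair?
      ≡⟨ cong (3 *_) count₂-Pair ⟩
    3 * (suc (suc k) * suc k)
      ∎
    where open ≤-Reasoning

6*m+4*[1+r]≤3*[1+r]*r⇒m≤⌊[r+1][3r-4]/6⌋ : ∀ {m r} → 2 ≤ r → 6 * m + 4 * suc r ≤ 3 * (suc r * r) →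
                                           m ≤ (r + 1) * (3 * r ∸ 4) / 6
6*m+4*[1+r]≤3*[1+r]*r⇒m≤⌊[r+1][3r-4]/6⌋ {m} {r} 2≤r bound = begin
  m                              ≡⟨ m*n/n≡m m 6 ⟨
  m * 6 / 6                      ≤⟨ /-monoˡ-≤ 6 (≤-trans (≤-reflexive (*-comm m 6)) 6m≤) ⟩
  (r + 1) * (3 * r ∸ 4) / 6      ∎
  where
  open ≤-Reasoning
  4≤3r : 4 ≤ 3 * r
  4≤3r = ≤-trans (s≤s (s≤s (s≤s (s≤s z≤n)))) (*-monoʳ-≤ 3 2≤r)
  expand : ∀ r → (r + 1) * (3 * r) ≡ 3 * (suc r * r)
  expand = solve-∀
  split : (r + 1) * (3 * r ∸ 4) + 4 * suc r ≡ 3 * (suc r * r)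
  split = begin-equality
    (r + 1) * (3 * r ∸ 4) + 4 * suc r    ≡⟨ cong ((r + 1) * (3 * r ∸ 4) +_) (*-comm 4 (suc r)) ⟩
    (r + 1) * (3 * r ∸ 4) + suc r * 4    ≡⟨ cong (λ t → (r + 1) * (3 * r ∸ 4) + t * 4) (+-comm 1 r) ⟩
    (r + 1) * (3 * r ∸ 4) + (r + 1) * 4  ≡⟨ *-distribˡ-+ (r + 1) (3 * r ∸ 4) 4 ⟨
    (r + 1) * (3 * r ∸ 4 + 4)            ≡⟨ cong ((r + 1) *_) (m∸n+n≡m 4≤3r) ⟩
    (r + 1) * (3 * r)                    ≡⟨ expand r ⟩
    3 * (suc r * r)                      ∎
  6m≤ : 6 * m ≤ (r + 1) * (3 * r ∸ 4)
  6m≤ = +-cancelʳ-≤ (4 * suc r) (6 * m) _ (≤-trans bound (≤-reflexive (sym split)))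

proposition9 : (r n : ℕ) → 3 ≤ r → (H : Hypergraph n) → IsFriendshipHypergraph r H →
    (q : Subset n) → Decomposition r H q → (z : Fin n) → z ∉ q →
    AtMost (λ q′ → Decomposition r H q′ × z ∈ q′ × ∣ q′ ∩ q ∣ ≡ r ∸ 1)
      (((r + 1) * (3 * r ∸ 4)) / 6)
proposition9 (suc k) n (s≤s 2≤k) H friendship q dq z z∉q xs unique goods =
  6*m+4*[1+r]≤3*[1+r]*r⇒m≤⌊[r+1][3r-4]/6⌋ (m≤n⇒m≤1+n 2≤k)
    (AroundHyperedge.6*length+4*∣q∣≤3*pairs friendship dq z∉q unique goods)
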